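{- For every integer base $b\geq 2$, the Liouville word $\mathbf{a}=a_1a_2a_3\cdots$, defined by $a_k=1$ if $k=j!$ for some positive integer $j$ and $a_k=0$ otherwise (so $\mathbf{a}=11000100000000000000000100\cdots$), is partially finite factorial with respect to $b$.
   Context: For an infinite word $a_1a_2\cdots$ over $\{0,\dots,b-1\}$ and $k\ge1$ let $u_k=\sum_{i=1}^ka_ib^{k-i}$. For a finite set $S$ of primes and a positive integer $r$, the $S$-component $c_{r,S}$ is the largest divisor of $r$ all of whose prime factors lie in $S$. The word is partially finite factorial with respect to $b$ if there exist a finite set $S$ of primes, a strictly increasing sequence $(n_i)_{i\ge1}$ of positive integers and $\epsilon\in(0,1]$ such that $c_{u_{n_i},S}/u_{n_i}\geq b^{(\epsilon-1)n_i}$ for all $i\geq1$. -}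

module Defs where

open import Data.Nat using (ℕ; zero; suc; _+_; _*_; _∸_; _^_; _≤_; _<_; _!; _≡ᵇ_)
open import Data.Nat.Divisibility using (_∣_)
open import Data.Nat.Primality using (Prime)
open import Data.Bool using (Bool; true; false; _∨_; if_then_else_)
open import Data.List using (List)
open import Data.List.Relation.Unary.All using (All)
open import Data.List.Membership.Propositional using (_∈_)
open import Data.Product using (Σ; _×_)

-- An infinite word is a function ℕ → ℕ, read 1-indexed: a k is the letter a_k (k ≥ 1).
Word : Set
Word = ℕ → ℕ

WordOver : ℕ → Word → Set
WordOver b a = ∀ k → a k < b

-- u_k = Σ_{i=1}^k a_i b^{k-i}, computed by Horner's rule.
u : ℕ → Word → ℕ → ℕ
u b a zero    = 0
u b a (suc k) = u b a k * b + a (suc k)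

SSmooth : List ℕ → ℕ → Set
SSmooth S d = ∀ p → Prime p → p ∣ d → p ∈ S

IsSComponent : List ℕ → ℕ → ℕ → Set
IsSComponent S r c = c ∣ r × SSmooth S c × (∀ d → d ∣ r → SSmooth S d → d ≤ c)

-- Partially finite factorial w.r.t. b.  ε ∈ (0,1] is taken rational, ε = p/q with 0 < p ≤ q,
-- and  c/u ≥ b^{(ε-1)n}  is rewritten equivalently as  u^q ≤ c^q · b^{(q-p)n}.
PartiallyFiniteFactorial : ℕ → Word → Set
PartiallyFiniteFactorial b a =
  Σ (List ℕ) λ S → All Prime S ×
  Σ (ℕ → ℕ) λ n → (∀ i → n i < n (suc i)) × (∀ i → 1 ≤ n i) ×
  Σ ℕ λ p → Σ ℕ λ q → 1 ≤ p × p ≤ q ×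
  (∀ i → Σ ℕ λ c → IsSComponent S (u b a (n i)) c ×
           (u b a (n i)) ^ q ≤ c ^ q * b ^ ((q ∸ p) * n i))

isFact : ℕ → ℕ → Bool
isFact zero    k = false
isFact (suc j) k = ((suc j) ! ≡ᵇ k) ∨ isFact j k

-- Liouville word: a_k = 1 iff k = j! for some j ≥ 1 (such j satisfies j ≤ j! = k).
liouville : Word
liouville k = if isFact k k then 1 else 0

{-# OPTIONS --safe #-}
-- Let F = m! with m ≥ 2 and n = 2F. Since (m+1)! > 2·m!, the Liouville word has a 1 at
-- position F and zeros at F+1, …, 2F, so u_n = u_F · b^F with u_F ≡ 1 (mod b) and u_F < b^F.
-- Thus u_F is coprime to every S-smooth number, S being the primes of b, the S-component of
-- u_n is exactly b^F, and u_n / b^F < b^F = b^(n/2): the definition holds with ε = 1/2.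
module Submission where

open import Defs
open import Data.Nat.Base
open import Data.Nat.Properties
open import Data.Nat.Combinatorics using (k![n∸k]!∣n!)
open import Data.Nat.Divisibility
open import Data.Nat.Primality using (Prime; ¬prime[1]; euclidsLemma)
open import Data.Nat.Coprimality using (Coprime; coprime-divisor)
open import Data.Nat.Primality.Factorisation using (PrimeFactorisation; factorise; factorisationHasAllPrimeFactors)
open import Data.Nat.ListAction using (product)
open import Data.Nat.ListAction.Properties using (∈⇒∣product)
open import Data.Bool.Base using (true; false; T)
open import Data.Bool.Properties using (T-≡; T-∨)
open import Data.Empty using (⊥-elim)
open import Data.List.Base using (List; []; _∷_)
open import Data.List.Membership.Propositional using (_∈_)
open import Data.List.Relation.Unary.All using (All; []; _∷_)
open import Data.Product using (_×_; _,_)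
open import Data.Sum using (inj₁; inj₂)
open import Function.Bundles using (Equivalence)
open import Relation.Nullary using (¬_; yes; no)
open import Relation.Binary.PropositionalEquality

open PrimeFactorisation using (factors; isFactorisation; factorsPrime)
open Equivalence using (to; from)

private
  variable
    b c d i j k m n p s : ℕ
    a : Word
    S : List ℕ

!-mono-≤ : m ≤ n → m ! ≤ n !
!-mono-≤ {m} {n} m≤n = ∣⇒≤ {{n !≢0}} (∣-trans (m∣m*n ((n ∸ m) !)) (k![n∸k]!∣n! m≤n))

n≤n! : ∀ n → n ≤ n !
n≤n! zero    = z≤n
n≤n! (suc n) = m≤m*n (suc n) (n !) {{n !≢0}}

!-≢-between : m ! < k → k < suc m ! → ∀ j → j ! ≢ k
!-≢-between {m} m!<k k<m+1! j j!≡k with j ≤? m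
... | yes j≤m = <⇒≱ m!<k (subst (_≤ m !) j!≡k (!-mono-≤ j≤m))
... | no  j≰m = <⇒≱ k<m+1! (subst (suc m ! ≤_) j!≡k (!-mono-≤ (≰⇒> j≰m)))

!+!<suc! : 2 ≤ m → m ! + m ! < suc m !
!+!<suc! {m} 2≤m =
  +-monoʳ-< (m !) (subst (_< m * m !) (*-identityˡ (m !)) (*-monoˡ-< (m !) {{m !≢0}} 2≤m))

isFact-! : 1 ≤ i → i ≤ j → T (isFact j (i !))
isFact-! {i} {zero}  1≤i i≤0 = ⊥-elim (<⇒≱ 1≤i i≤0)
isFact-! {i} {suc j} 1≤i i≤1+j with i ≟ suc j
... | yes refl = from T-∨ (inj₁ (≡⇒≡ᵇ (i !) (i !) refl))
... | no  i≢1+j = from T-∨ (inj₂ (isFact-! 1≤i (m<1+n⇒m≤n (≤∧≢⇒< i≤1+j i≢1+j))))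

isFact-≢! : (∀ i → i ! ≢ k) → ∀ j → ¬ T (isFact j k)
isFact-≢! {k} ≢! (suc j) t with to T-∨ t
... | inj₁ j!≡ᵇk = ≢! (suc j) (≡ᵇ⇒≡ (suc j !) k j!≡ᵇk)
... | inj₂ t′     = isFact-≢! ≢! j t′

liouville-! : 1 ≤ m → liouville (m !) ≡ 1
liouville-! {m} 1≤m rewrite to T-≡ (isFact-! 1≤m (n≤n! m)) = refl

liouville-≢! : (∀ j → j ! ≢ k) → liouville k ≡ 0
liouville-≢! {k} ≢! with isFact k k in eq
... | true  = ⊥-elim (isFact-≢! ≢! k (from T-≡ eq))
... | false = refl

liouville-gap : 2 ≤ m → m ! < k → k ≤ m ! + m ! → liouville k ≡ 0
liouville-gap {m} 2≤m m!<k k≤2m! =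
  liouville-≢! (!-≢-between {m} m!<k (≤-<-trans k≤2m! (!+!<suc! 2≤m)))

liouville-wordOver : 2 ≤ b → WordOver b liouville
liouville-wordOver {b} 2≤b k with isFact k k
... | true  = 2≤b
... | false = ≤-trans (s≤s z≤n) 2≤b

u<b^ : WordOver b a → ∀ k → u b a k < b ^ k
u<b^ {b} {a} a<b zero    = s≤s z≤n
u<b^ {b} {a} a<b (suc k) = begin-strict
  u b a k * b + a (suc k) <⟨ +-monoʳ-< (u b a k * b) (a<b (suc k)) ⟩
  u b a k * b + b         ≡⟨ +-comm (u b a k * b) b ⟩
  suc (u b a k) * b       ≤⟨ *-monoˡ-≤ b (u<b^ a<b k) ⟩
  b ^ k * b               ≡⟨ *-comm (b ^ k) b ⟩
  b ^ suc k               ∎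
  where open ≤-Reasoning

u-+-zeros : (∀ i → k < i → i ≤ k + s → a i ≡ 0) → u b a (k + s) ≡ u b a k * b ^ s
u-+-zeros {k} {zero}  {a} {b} _ rewrite +-identityʳ k = sym (*-identityʳ (u b a k))
u-+-zeros {k} {suc s} {a} {b} zeros rewrite +-suc k s = begin
  u b a (k + s) * b + a (suc (k + s)) ≡⟨ cong₂ (λ x y → x * b + y) (u-+-zeros zeros′) a[k+s+1]≡0 ⟩
  u b a k * b ^ s * b + 0             ≡⟨ +-identityʳ _ ⟩
  u b a k * b ^ s * b                 ≡⟨ *-assoc (u b a k) (b ^ s) b ⟩
  u b a k * (b ^ s * b)               ≡⟨ cong (u b a k *_) (*-comm (b ^ s) b) ⟩
  u b a k * b ^ suc s                 ∎
  where
  open ≡-Reasoning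
  zeros′ : ∀ i → k < i → i ≤ k + s → a i ≡ 0
  zeros′ i k<i i≤k+s = zeros i k<i (m≤n⇒m≤1+n i≤k+s)
  a[k+s+1]≡0 : a (suc (k + s)) ≡ 0
  a[k+s+1]≡0 = zeros (suc (k + s)) (s≤s (m≤m+n k s)) ≤-refl

u-suc-one : a (suc k) ≡ 1 → u b a (suc k) ≡ suc (u b a k * b)
u-suc-one {a} {k} {b} a[k+1]≡1 = trans (cong (u b a k * b +_) a[k+1]≡1) (+-comm (u b a k * b) 1)

primeFactors : (n : ℕ) → .{{NonZero n}} → List ℕ
primeFactors n = factors (factorise n)

∈primeFactors⇒∣ : .{{_ : NonZero n}} → p ∈ primeFactors n → p ∣ n
∈primeFactors⇒∣ {n} p∈ = subst (_ ∣_) (sym (isFactorisation (factorise n))) (∈⇒∣product p∈)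

prime∣⇒∈primeFactors : .{{_ : NonZero n}} → Prime p → p ∣ n → p ∈ primeFactors n
prime∣⇒∈primeFactors {n} p-prime p∣n = factorisationHasAllPrimeFactors p-prime
  (subst (_ ∣_) (isFactorisation (factorise n)) p∣n) (factorsPrime (factorise n))

noPrimeDivisor⇒≡1 : .{{_ : NonZero n}} → (∀ {p} → Prime p → ¬ p ∣ n) → n ≡ 1
noPrimeDivisor⇒≡1 {n} noDivisor = go (factors f) (isFactorisation f) (factorsPrime f)
  where
  f : PrimeFactorisation n
  f = factorise n
  go : ∀ ps → n ≡ product ps → All Prime ps → n ≡ 1
  go []       n≡1 _ = n≡1
  go (q ∷ qs) n≡q*qs (q-prime ∷ _) =
    ⊥-elim (noDivisor q-prime (subst (q ∣_) (sym n≡q*qs) (m∣m*n (product qs))))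

prime∣^⇒∣ : Prime p → ∀ k → p ∣ m ^ k → p ∣ m
prime∣^⇒∣ p-prime zero    p∣1 = ⊥-elim (¬prime[1] (subst Prime (∣1⇒≡1 p∣1) p-prime))
prime∣^⇒∣ {m = m} p-prime (suc k) p∣m^k+1 with euclidsLemma m (m ^ k) p-prime p∣m^k+1
... | inj₁ p∣m   = p∣m
... | inj₂ p∣m^k = prime∣^⇒∣ p-prime k p∣m^k

^-smooth : .{{_ : NonZero b}} → ∀ k → SSmooth (primeFactors b) (b ^ k)
^-smooth k p p-prime p∣b^k = prime∣⇒∈primeFactors p-prime (prime∣^⇒∣ p-prime k p∣b^k)

smooth⇒coprime : .{{_ : NonZero b}} → .{{_ : NonZero n}} →
                 Coprime b n → SSmooth (primeFactors b) d → Coprime d n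
smooth⇒coprime {b} {n} b⊥n d-smooth {i} (i∣d , i∣n) = noPrimeDivisor⇒≡1 {{i≢0}} noCommonPrime
  where
  i≢0 : NonZero i
  i≢0 = ≢-nonZero λ { refl → ≢-nonZero⁻¹ n (0∣⇒≡0 i∣n) }
  noCommonPrime : ∀ {p} → Prime p → ¬ p ∣ i
  noCommonPrime {p} p-prime p∣i = ¬prime[1] (subst Prime p≡1 p-prime)
    where
    p≡1 : p ≡ 1
    p≡1 = b⊥n (∈primeFactors⇒∣ (d-smooth _ p-prime (∣-trans p∣i i∣d)) , ∣-trans p∣i i∣n)

coprime-suc-* : ∀ x b → Coprime b (suc (x * b))
coprime-suc-* x b {i} (i∣b , i∣1+xb) =
  ∣1⇒≡1 (∣m+n∣m⇒∣n (subst (i ∣_) (+-comm 1 (x * b)) i∣1+xb) (∣n⇒∣m*n x i∣b))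

*-isSComponent : .{{_ : NonZero c}} → SSmooth S c → (∀ {d} → SSmooth S d → Coprime d m) →
                 IsSComponent S (m * c) c
*-isSComponent {m = m} c-smooth coprime =
  n∣m*n m , c-smooth , λ d d∣mc d-smooth → ∣⇒≤ (coprime-divisor (coprime d-smooth) d∣mc)

isolatedOne⇒SComponent : .{{_ : NonZero b}} → .{{_ : NonZero n}} → WordOver b a → a n ≡ 1 →
  (∀ i → n < i → i ≤ n + n → a i ≡ 0) →
  IsSComponent (primeFactors b) (u b a (n + n)) (b ^ n) ×
  u b a (n + n) ^ 2 ≤ (b ^ n) ^ 2 * b ^ ((2 ∸ 1) * (n + n))
isolatedOne⇒SComponent {b} {n@(suc k)} {a} a<b a[n]≡1 zeros =
  subst (λ v → IsSComponent (primeFactors b) v bⁿ × v ^ 2 ≤ bⁿ ^ 2 * b ^ ((2 ∸ 1) * (n + n)))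
        (sym u[n+n]≡A*bⁿ)
        ( *-isSComponent {{m^n≢0 b n}} (^-smooth {b} n) (smooth⇒coprime (coprime-suc-* (u b a k) b))
        , bound)
  where
  bⁿ : ℕ
  bⁿ = b ^ n
  A : ℕ
  A = suc (u b a k * b)
  u[n]≡A : u b a n ≡ A
  u[n]≡A = u-suc-one {a} {k} {b} a[n]≡1
  u[n+n]≡A*bⁿ : u b a (n + n) ≡ A * bⁿ
  u[n+n]≡A*bⁿ = trans (u-+-zeros zeros) (cong (_* bⁿ) u[n]≡A)
  A≤bⁿ : A ≤ bⁿ
  A≤bⁿ = <⇒≤ (subst (_< bⁿ) u[n]≡A (u<b^ a<b n))
  bound : (A * bⁿ) ^ 2 ≤ bⁿ ^ 2 * b ^ ((2 ∸ 1) * (n + n))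
  bound = begin
    (A * bⁿ) ^ 2                     ≤⟨ ^-monoˡ-≤ 2 (*-monoˡ-≤ bⁿ A≤bⁿ) ⟩
    (bⁿ * bⁿ) * ((bⁿ * bⁿ) * 1)      ≡⟨ cong ((bⁿ * bⁿ) *_) (*-identityʳ (bⁿ * bⁿ)) ⟩
    (bⁿ * bⁿ) * (bⁿ * bⁿ)            ≡⟨ cong₂ _*_ (cong (bⁿ *_) (sym (*-identityʳ bⁿ)))
                                                  (sym (^-distribˡ-+-* b n n)) ⟩
    bⁿ ^ 2 * b ^ (n + n)             ≡⟨ cong (λ e → bⁿ ^ 2 * b ^ e) (sym (+-identityʳ (n + n))) ⟩
    bⁿ ^ 2 * b ^ ((2 ∸ 1) * (n + n)) ∎
    where open ≤-Reasoning

proposition3p3 : (b : ℕ) → 2 ≤ b → PartiallyFiniteFactorial b liouville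
proposition3p3 (suc zero) (s≤s ())
proposition3p3 b@(suc (suc _)) 2≤b =
  primeFactors b , factorsPrime (factorise b) ,
  (λ i → F i + F i) , F+F-increasing , (λ i → ≤-trans (1≤n! (2+ i)) (m≤m+n (F i) (F i))) ,
  1 , 2 , ≤-refl , s≤s z≤n ,
  λ i → b ^ F i , isolatedOne⇒SComponent {{_}} {{2+ i !≢0}} (liouville-wordOver 2≤b)
                    (liouville-! {2+ i} (s≤s z≤n)) (λ _ → liouville-gap {2+ i} (2≤2+ i))
  where
  2≤2+ : ∀ i → 2 ≤ 2+ i
  2≤2+ i = s≤s (s≤s z≤n)
  F : ℕ → ℕ
  F i = 2+ i !
  F+F-increasing : ∀ i → F i + F i < F (suc i) + F (suc i)
  F+F-increasing i = +-mono-< F<F F<F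
    where
    F<F : F i < F (suc i)
    F<F = ≤-<-trans (m≤m+n (F i) (F i)) (!+!<suc! {2+ i} (2≤2+ i))
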